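{- $T_0$ and $T_1$ are both anticonnected, contain no simplicial vertices and no universal vertices, and are $(2P_3,C_4,C_6,C_7)$-free. Consequently, any thickening of $T_0$ or $T_1$ is anticonnected, contains no simplicial and no universal vertices, and is $(2P_3,C_4,C_6,C_7)$-free.
   Context: All graphs are finite, simple and nonnull. A graph is anticonnected if its complement is connected. A simplicial vertex is one whose neighborhood is a (possibly empty) clique; a universal vertex is adjacent to all other vertices. $G$ is $H$-free if no induced subgraph is isomorphic to $H$; $2P_3$ is two disjoint copies of the 3-vertex path; $C_k$ is the $k$-cycle. A thickening of $H$ is a graph $H^*$ with pairwise disjoint nonempty cliques $X_v$ ($v\in V(H)$) partitioning $V(H^*)$ such that for distinct $u,v$, $X_u$ is complete to $X_v$ if $uv\in E(H)$ and anticomplete otherwise. $T_0$ has vertices $a_0,a_1,b_0,b_1,b_2,b_3,c_1,c_2,c_3$ and edges $a_0a_1$, $a_0b_0,a_0b_2,a_0b_3$, $a_1b_1,a_1b_2,a_1b_3$, $c_1c_2,c_1c_3,c_2c_3$, $c_1b_0,c_1b_1$, $c_2b_2$, $c_3b_3$. $T_1$ is $T_0$ plus a vertex $f_3$ adjacent exactly to $a_0,a_1,b_0,b_1,b_2,c_1,c_2$. -}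

module Defs where

open import Data.Nat using (ℕ; zero; suc; _≥_; s≤s; z≤n)
open import Data.Fin using (Fin; zero; suc; _≟_; #_)
open import Data.Bool using (Bool; true; false; _∨_; _∧_; not)
open import Data.Empty using (⊥-elim)
open import Data.Bool.Properties using (∨-comm)
open import Data.List using (List; []; _∷_)
open import Data.Product using (Σ; ∃; _×_; _,_)
open import Relation.Nullary using (¬_; yes; no)
open import Relation.Nullary.Decidable using (⌊_⌋)
open import Relation.Binary.PropositionalEquality using (_≡_; _≢_; refl)
open import Function.Definitions using (Injective; Surjective)

record Graph : Set where
  field
    n       : ℕ
    nonnull : n ≥ 1
    adj     : Fin n → Fin n → Bool
    sym     : ∀ x y → adj x y ≡ adj y x
    irrefl  : ∀ x → adj x x ≡ false
open Graph public

V : Graph → Set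
V G = Fin (n G)

Adj : (G : Graph) → V G → V G → Set
Adj G x y = adj G x y ≡ true

coAdj : (G : Graph) → V G → V G → Set
coAdj G x y = (x ≢ y) × (adj G x y ≡ false)

data Walk {A : Set} (R : A → A → Set) : A → A → Set where
  stop : ∀ {x} → Walk R x x
  step : ∀ {x y z} → R x y → Walk R y z → Walk R x z

Connected : Graph → Set
Connected G = ∀ (x y : V G) → Walk (Adj G) x y

Anticonnected : Graph → Set
Anticonnected G = ∀ (x y : V G) → Walk (coAdj G) x y

Simplicial : (G : Graph) → V G → Set
Simplicial G v = ∀ u w → Adj G v u → Adj G v w → u ≢ w → Adj G u w

Universal : (G : Graph) → V G → Set
Universal G v = ∀ u → u ≢ v → Adj G v u

NoSimplicial : Graph → Set
NoSimplicial G = ∀ v → ¬ Simplicial G v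

NoUniversal : Graph → Set
NoUniversal G = ∀ v → ¬ Universal G v

InducedSub : Graph → Graph → Set
InducedSub H G =
  Σ (V H → V G) λ f → Injective _≡_ _≡_ f × (∀ x y → adj G (f x) (f y) ≡ adj H x y)

Free : Graph → Graph → Set
Free H G = ¬ InducedSub H G

-- thickening: p maps each vertex of G to the clique X_v containing it
IsThickening : (G H : Graph) → Set
IsThickening G H =
  Σ (V G → V H) λ p →
      Surjective _≡_ _≡_ p                                   -- each X_v nonempty
    × (∀ x y → x ≢ y → p x ≡ p y → Adj G x y)
    × (∀ x y → p x ≢ p y → adj G x y ≡ adj H (p x) (p y))    -- complete / anticomplete

mem : ∀ {k} → Fin k → Fin k → List (Fin k × Fin k) → Bool
mem x y [] = false
mem x y ((a , b) ∷ es) = (⌊ x ≟ a ⌋ ∧ ⌊ y ≟ b ⌋) ∨ mem x y es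

edgeAdj : ∀ {k} → List (Fin k × Fin k) → Fin k → Fin k → Bool
edgeAdj E x y = not ⌊ x ≟ y ⌋ ∧ (mem x y E ∨ mem y x E)

edgeSym : ∀ {k} (E : List (Fin k × Fin k)) x y → edgeAdj E x y ≡ edgeAdj E y x
edgeSym E x y with x ≟ y | y ≟ x
... | yes refl | yes _ = refl
... | yes refl | no ¬p = ⊥-elim (¬p refl)
... | no ¬p | yes refl = ⊥-elim (¬p refl)
... | no _ | no _ = ∨-comm (mem x y E) (mem y x E)

edgeIrr : ∀ {k} (E : List (Fin k × Fin k)) x → edgeAdj E x x ≡ false
edgeIrr E x with x ≟ x
... | yes _ = refl
... | no ¬p = ⊥-elim (¬p refl)

mkGraph : (k : ℕ) → List (Fin (suc k) × Fin (suc k)) → Graph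
mkGraph k E = record { n = suc k ; nonnull = s≤s z≤n ; adj = edgeAdj E
                     ; sym = edgeSym E ; irrefl = edgeIrr E }

-- T₀ vertex numbering: a0=0 a1=1 b0=2 b1=3 b2=4 b3=5 c1=6 c2=7 c3=8
T₀ : Graph
T₀ = mkGraph 8
  ( (# 0 , # 1)
  ∷ (# 0 , # 2) ∷ (# 0 , # 4) ∷ (# 0 , # 5)
  ∷ (# 1 , # 3) ∷ (# 1 , # 4) ∷ (# 1 , # 5)
  ∷ (# 6 , # 7) ∷ (# 6 , # 8) ∷ (# 7 , # 8)
  ∷ (# 6 , # 2) ∷ (# 6 , # 3)
  ∷ (# 7 , # 4) ∷ (# 8 , # 5)
  ∷ [])

-- T₁ = T₀ plus f3 = 9 adjacent exactly to a0 a1 b0 b1 b2 c1 c2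
T₁ : Graph
T₁ = mkGraph 9
  ( (# 0 , # 1)
  ∷ (# 0 , # 2) ∷ (# 0 , # 4) ∷ (# 0 , # 5)
  ∷ (# 1 , # 3) ∷ (# 1 , # 4) ∷ (# 1 , # 5)
  ∷ (# 6 , # 7) ∷ (# 6 , # 8) ∷ (# 7 , # 8)
  ∷ (# 6 , # 2) ∷ (# 6 , # 3)
  ∷ (# 7 , # 4) ∷ (# 8 , # 5)
  ∷ (# 9 , # 0) ∷ (# 9 , # 1) ∷ (# 9 , # 2) ∷ (# 9 , # 3)
  ∷ (# 9 , # 4) ∷ (# 9 , # 6) ∷ (# 9 , # 7)
  ∷ [])

twoP₃ : Graph
twoP₃ = mkGraph 5 ((# 0 , # 1) ∷ (# 1 , # 2) ∷ (# 3 , # 4) ∷ (# 4 , # 5) ∷ [])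

C₄ : Graph
C₄ = mkGraph 3 ((# 0 , # 1) ∷ (# 1 , # 2) ∷ (# 2 , # 3) ∷ (# 3 , # 0) ∷ [])

C₆ : Graph
C₆ = mkGraph 5 ((# 0 , # 1) ∷ (# 1 , # 2) ∷ (# 2 , # 3) ∷ (# 3 , # 4)
              ∷ (# 4 , # 5) ∷ (# 5 , # 0) ∷ [])

C₇ : Graph
C₇ = mkGraph 6 ((# 0 , # 1) ∷ (# 1 , # 2) ∷ (# 2 , # 3) ∷ (# 3 , # 4)
              ∷ (# 4 , # 5) ∷ (# 5 , # 6) ∷ (# 6 , # 0) ∷ [])

Good : Graph → Set
Good G = Anticonnected G × NoSimplicial G × NoUniversal G
       × Free twoP₃ G × Free C₄ G × Free C₆ G × Free C₇ G

{-# OPTIONS --safe #-}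
-- For T₀ and T₁ every property is decided by evaluation: their complements have
-- diameter at most two, no vertex is simplicial or universal, and a backtracking
-- search finds no induced 2P₃, C₄, C₆ or C₇. A thickening G of H inherits each
-- property from H: a simplicial or universal vertex of G makes its class
-- simplicial or universal in H; walks in the complement of H lift to G, two
-- vertices of one clique being joined through a non-neighbouring class; and two
-- vertices of an induced subgraph F of G lying in one clique are true twins of F,
-- which 2P₃, C₄, C₆ and C₇ do not have, so F projects to an induced copy in H.
module Submission where

open import Defs
open import Data.Bool using (Bool; true; false; not; T)
open import Data.Bool.Properties using (¬-not; T-not-≡) renaming (_≟_ to _≟ᵇ_)
open import Data.Empty using (⊥-elim)
open import Data.Fin using (_≟_)
open import Data.Fin.Properties using (all?; any?; ¬∀⟶∃¬)
open import Data.List using (List; []; _∷_; map; allFin)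
open import Data.List.Relation.Unary.All as All using ()
open import Data.List.Relation.Unary.All.Properties using (map⁺)
open import Data.Product using (_×_; ∃; _,_; proj₁; proj₂)
open import Data.Sum using (_⊎_; inj₁; inj₂)
open import Function using (_∘_; Equivalence)
open import Function.Definitions using (Injective)
open import Relation.Nullary using (¬_; Dec; yes; no; ¬?)
open import Relation.Nullary.Decidable
  using (_×-dec_; _⊎-dec_; _→-dec_; T?; isYes; True; toWitness; fromWitness; from-yes)
open import Relation.Binary.PropositionalEquality as ≡
  using (_≡_; _≢_; refl; trans; cong; subst)

adj? : (G : Graph) (x y : V G) → Dec (Adj G x y)
adj? G x y = adj G x y ≟ᵇ true

coAdj? : (G : Graph) (x y : V G) → Dec (coAdj G x y)
coAdj? G x y = ¬? (x ≟ y) ×-dec (adj G x y ≟ᵇ false)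

Adj⇒≢ : (G : Graph) {x y : V G} → Adj G x y → x ≢ y
Adj⇒≢ G {x} xy refl with () ← trans (≡.sym xy) (irrefl G x)

coAdj-sym : (G : Graph) {x y : V G} → coAdj G x y → coAdj G y x
coAdj-sym G {x} {y} (x≢y , xy) = x≢y ∘ ≡.sym , trans (sym G y x) xy

universal? : (G : Graph) (v : V G) → Dec (Universal G v)
universal? G v = all? λ u → ¬? (u ≟ v) →-dec adj? G v u

noUniversal? : (G : Graph) → Dec (NoUniversal G)
noUniversal? G = all? λ v → ¬? (universal? G v)

¬Universal⇒coNeighbour : (G : Graph) {v : V G} → ¬ Universal G v → ∃ (coAdj G v)
¬Universal⇒coNeighbour G {v} ¬univ with ¬∀⟶∃¬ (n G) _ (λ u → ¬? (u ≟ v) →-dec adj? G v u) ¬univ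
... | u , ¬adjacent = u , (λ v≡u → ¬adjacent λ u≢v → ⊥-elim (u≢v (≡.sym v≡u)))
                        , ¬-not (λ vu → ¬adjacent λ _ → vu)

simplicial? : (G : Graph) (v : V G) → Dec (Simplicial G v)
simplicial? G v = all? λ u → all? λ w →
  adj? G v u →-dec (adj? G v w →-dec (¬? (u ≟ w) →-dec adj? G u w))

noSimplicial? : (G : Graph) → Dec (NoSimplicial G)
noSimplicial? G = all? λ v → ¬? (simplicial? G v)

CoDistance≤2 : (G : Graph) → V G → V G → Set
CoDistance≤2 G x y = x ≡ y ⊎ coAdj G x y ⊎ ∃ λ w → coAdj G x w × coAdj G w y

CoDiameter≤2 : Graph → Set
CoDiameter≤2 G = ∀ x y → CoDistance≤2 G x y

coDiameter≤2? : (G : Graph) → Dec (CoDiameter≤2 G)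
coDiameter≤2? G = all? λ x → all? λ y →
  x ≟ y ⊎-dec coAdj? G x y ⊎-dec any? λ w → coAdj? G x w ×-dec coAdj? G w y

coDiameter≤2⇒anticonnected : (G : Graph) → CoDiameter≤2 G → Anticonnected G
coDiameter≤2⇒anticonnected G close x y with close x y
... | inj₁ refl                  = stop
... | inj₂ (inj₁ xy)             = step xy stop
... | inj₂ (inj₂ (w , xw , wy)) = step xw (step wy stop)

TrueTwins : (G : Graph) → V G → V G → Set
TrueTwins G x y = x ≢ y × Adj G x y × (∀ z → z ≢ x → z ≢ y → adj G x z ≡ adj G y z)

NoTrueTwins : Graph → Set
NoTrueTwins G = ∀ x y → ¬ TrueTwins G x y

noTrueTwins? : (G : Graph) → Dec (NoTrueTwins G)
noTrueTwins? G = all? λ x → all? λ y → ¬?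
  (¬? (x ≟ y) ×-dec adj? G x y ×-dec
   all? λ z → ¬? (z ≟ x) →-dec (¬? (z ≟ y) →-dec (adj G x z ≟ᵇ adj G y z)))

module EmbeddingSearch (F H : Graph) where

  Compatible : V F × V H → V F × V H → Set
  Compatible (x , y) (x′ , y′) = (y ≡ y′ → x ≡ x′) × adj H y y′ ≡ adj F x x′

  compatible? : ∀ p q → Dec (Compatible p q)
  compatible? (x , y) (x′ , y′) = (y ≟ y′ →-dec x ≟ x′) ×-dec (adj H y y′ ≟ᵇ adj F x x′)

  -- Only completeness of this search is proved (an induced embedding makes it
  -- succeed), which is all that freeness needs.
  extensible : List (V F) → List (V F × V H) → Bool
  extensible []       ps = true
  extensible (x ∷ xs) ps = isYes (any? λ y →
    All.all? (compatible? (x , y)) ps ×-dec T? (extensible xs ((x , y) ∷ ps)))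

  embeds : Bool
  embeds = extensible (allFin (n F)) []

  module _ (f : V F → V H) (injective : Injective _≡_ _≡_ f)
           (induced : ∀ x y → adj H (f x) (f y) ≡ adj F x y) where

    graph : List (V F) → List (V F × V H)
    graph = map λ x → x , f x

    extensible-graph : ∀ xs ys → T (extensible xs (graph ys))
    extensible-graph []       ys = _
    extensible-graph (x ∷ xs) ys = fromWitness
      (f x , map⁺ (All.universal (λ x′ → injective , induced x x′) ys)
           , extensible-graph xs (x ∷ ys))

  ¬embeds⇒free : T (not embeds) → Free F H
  ¬embeds⇒free ¬found (f , injective , induced) =
    subst T (Equivalence.to T-not-≡ ¬found) (extensible-graph f injective induced (allFin (n F)) [])

open EmbeddingSearch using (embeds; ¬embeds⇒free)

module Thickening (G H : Graph) (thickening : IsThickening G H) where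

  class : V G → V H
  class = proj₁ thickening

  rep : V H → V G
  rep a = proj₁ (proj₁ (proj₂ thickening) a)

  class-rep : ∀ a → class (rep a) ≡ a
  class-rep a = proj₂ (proj₁ (proj₂ thickening) a) refl

  clique : ∀ x y → x ≢ y → class x ≡ class y → Adj G x y
  clique = proj₁ (proj₂ (proj₂ thickening))

  adj-classes : ∀ x y → class x ≢ class y → adj G x y ≡ adj H (class x) (class y)
  adj-classes = proj₂ (proj₂ (proj₂ thickening))

  adj-over : ∀ {x y a b} → class x ≡ a → class y ≡ b → a ≢ b → adj G x y ≡ adj H a b
  adj-over refl refl = adj-classes _ _

  coAdj-over : ∀ {x y a b} → class x ≡ a → class y ≡ b → coAdj H a b → coAdj G x y
  coAdj-over refl refl (a≢b , ab) = a≢b ∘ cong class , trans (adj-classes _ _ a≢b) ab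

  Adj-rep : ∀ {x a} → Adj H (class x) a → Adj G x (rep a)
  Adj-rep {a = a} xa = trans (adj-over refl (class-rep a) (Adj⇒≢ H xa)) xa

  rep≡⇒≡class : ∀ {a x} → rep a ≡ x → a ≡ class x
  rep≡⇒≡class {a} e = trans (≡.sym (class-rep a)) (cong class e)

  universal⇒class-universal : ∀ {v} → Universal G v → Universal H (class v)
  universal⇒class-universal univ u u≢v =
    trans (≡.sym (adj-over refl (class-rep u) (u≢v ∘ ≡.sym))) (univ (rep u) (u≢v ∘ rep≡⇒≡class))

  simplicial⇒class-simplicial : ∀ {v} → Simplicial G v → Simplicial H (class v)
  simplicial⇒class-simplicial simp u w vu vw u≢w =
    trans (≡.sym (adj-over (class-rep u) (class-rep w) u≢w))
          (simp (rep u) (rep w) (Adj-rep vu) (Adj-rep vw)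
                λ e → u≢w (trans (rep≡⇒≡class e) (class-rep w)))

  noUniversal : NoUniversal H → NoUniversal G
  noUniversal noU v = noU (class v) ∘ universal⇒class-universal

  noSimplicial : NoSimplicial H → NoSimplicial G
  noSimplicial noS v = noS (class v) ∘ simplicial⇒class-simplicial

  anticonnected : NoUniversal H → Anticonnected H → Anticonnected G
  anticonnected noU ac x y = lift (ac (class x) (class y)) refl refl
    where
      sameClass : ∀ {x y} → class x ≡ class y → Walk (coAdj G) x y
      sameClass {x} e with ¬Universal⇒coNeighbour H (noU (class x))
      ... | w , xw = step (coAdj-over refl (class-rep w) xw)
                          (step (coAdj-over (class-rep w) (≡.sym e) (coAdj-sym H xw)) stop)

      lift : ∀ {a b x y} → Walk (coAdj H) a b → class x ≡ a → class y ≡ b → Walk (coAdj G) x y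
      lift stop        refl e = sameClass (≡.sym e)
      lift (step ab w) refl e = step (coAdj-over refl (class-rep _) ab) (lift w (class-rep _) e)

  sameClass⇒sameAdj : ∀ {x y z} → class x ≡ class y → z ≢ x → z ≢ y → adj G x z ≡ adj G y z
  sameClass⇒sameAdj {x} {y} {z} e z≢x z≢y with class z ≟ class x
  ... | yes zx = trans (clique x z (z≢x ∘ ≡.sym) (≡.sym zx))
                       (≡.sym (clique y z (z≢y ∘ ≡.sym) (trans (≡.sym e) (≡.sym zx))))
  ... | no z≁x = trans (adj-over e refl y≁z) (≡.sym (adj-over refl refl y≁z))
    where
      y≁z : class y ≢ class z
      y≁z yz = z≁x (≡.sym (trans e yz))

  free : (F : Graph) → NoTrueTwins F → Free F H → Free F G
  free F noTwins freeH (f , injective , induced) = freeH (class ∘ f , injective′ , induced′)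
    where
      separated : ∀ {x y} → x ≢ y → class (f x) ≢ class (f y)
      separated {x} {y} x≢y e = noTwins x y
        ( x≢y
        , trans (≡.sym (induced x y)) (clique (f x) (f y) (x≢y ∘ injective) e)
        , λ z z≢x z≢y → trans (≡.sym (induced x z))
            (trans (sameClass⇒sameAdj e (z≢x ∘ injective) (z≢y ∘ injective)) (induced y z)))

      injective′ : Injective _≡_ _≡_ (class ∘ f)
      injective′ {x} {y} e with x ≟ y
      ... | yes x≡y = x≡y
      ... | no x≢y  = ⊥-elim (separated x≢y e)

      induced′ : ∀ x y → adj H (class (f x)) (class (f y)) ≡ adj F x y
      induced′ x y with x ≟ y
      ... | yes refl = trans (irrefl H _) (≡.sym (irrefl F x))
      ... | no x≢y   = trans (≡.sym (adj-classes (f x) (f y) (separated x≢y))) (induced x y)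

  good : Good H → Good G
  good (ac , noS , noU , free2P₃ , freeC₄ , freeC₆ , freeC₇) =
      anticonnected noU ac , noSimplicial noS , noUniversal noU
    , free twoP₃ (from-yes (noTrueTwins? twoP₃)) free2P₃
    , free C₄ (from-yes (noTrueTwins? C₄)) freeC₄
    , free C₆ (from-yes (noTrueTwins? C₆)) freeC₆
    , free C₇ (from-yes (noTrueTwins? C₇)) freeC₇

good-by-evaluation : (H : Graph)
  → True (coDiameter≤2? H) → True (noSimplicial? H) → True (noUniversal? H)
  → T (not (embeds twoP₃ H)) → T (not (embeds C₄ H))
  → T (not (embeds C₆ H)) → T (not (embeds C₇ H))
  → Good H
good-by-evaluation H close noS noU ¬2P₃ ¬C₄ ¬C₆ ¬C₇ =
    coDiameter≤2⇒anticonnected H (toWitness close) , toWitness noS , toWitness noU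
  , ¬embeds⇒free twoP₃ H ¬2P₃ , ¬embeds⇒free C₄ H ¬C₄
  , ¬embeds⇒free C₆ H ¬C₆ , ¬embeds⇒free C₇ H ¬C₇

good-T₀ : Good T₀
good-T₀ = good-by-evaluation T₀ _ _ _ _ _ _ _

good-T₁ : Good T₁
good-T₁ = good-by-evaluation T₁ _ _ _ _ _ _ _

proposition4p1 : (Good T₀ × Good T₁)
    × (∀ (G : Graph) → IsThickening G T₀ → Good G)
    × (∀ (G : Graph) → IsThickening G T₁ → Good G)
proposition4p1 = (good-T₀ , good-T₁)
               , (λ G thickening → Thickening.good G T₀ thickening good-T₀)
               , (λ G thickening → Thickening.good G T₁ thickening good-T₁)
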